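{- Let $\mathcal A=\langle Q,\Sigma,\Delta,\mathcal R\rangle$ be a tagged TA whose language consists of tagged $n$-qubit trees, let $t\in\{1,\dots,n\}$ and $b\in\{\mathrm{true},\mathrm{false}\}$. Let $Q'=\{q'\mid q\in Q\}$ be a disjoint copy of $Q$, let $\Delta'=\{q_0'\xrightarrow{x_j^i}(q_1',q_2')\mid q_0\xrightarrow{x_j^i}(q_1,q_2)\in\Delta\}\cup\{q_0'\xrightarrow{\mathbf 0}()\mid q_0\xrightarrow{c}()\in\Delta\}$ with $\mathbf 0=(0,0,0,0,0)$, and let $\mathsf{Res}(\mathcal A,x_t,b)$ be the TA with states $Q\cup Q'$, alphabet $\Sigma\cup\{\mathbf 0\}$, root states $\mathcal R$, and transitions obtained from $\Delta\cup\Delta'$ by replacing each transition $q\xrightarrow{x_t^i}(q_l,q_r)\in\Delta$ by $q\xrightarrow{x_t^i}(q_l',q_r)$ if $b=\mathrm{true}$ and by $q\xrightarrow{x_t^i}(q_l,q_r')$ if $b=\mathrm{false}$. Then $\mathsf{Res}(\mathcal A,x_t,b)\simeq_{\mathrm{Tag}}\mathcal A$, and \[\mathcal L(\mathsf{Res}(\mathcal A,x_t,b))=\{B_{x_t}\cdot T\mid T\in\mathcal L(\mathcal A)\}\text{ if }b=\mathrm{true},\qquad \{B_{\overline{x_t}}\cdot T\mid T\in\mathcal L(\mathcal A)\}\text{ if }b=\mathrm{false}.\]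
   Context: Tree automata: a TA is $\mathcal A=\langle Q,\Sigma,\Delta,\mathcal R\rangle$ with finite state set $Q$, ranked alphabet $\Sigma$ of binary and constant symbols, root states $\mathcal R\subseteq Q$, and transitions that are internal $q\xrightarrow{f}(q_0,q_1)$ or leaf $q\xrightarrow{c}()$. It is assumed no state has leaf transitions with two different constants. A run on a binary tree labels each node with a state so that each leaf labelled $c$ with state $q$ has $q\xrightarrow{c}()\in\Delta$ and each internal node labelled $f$ with state $q$ and children states $q_0$ (left), $q_1$ (right) has $q\xrightarrow{f}(q_0,q_1)\in\Delta$; accepting if the root state is in $\mathcal R$; $\mathcal L(\mathcal A)$ is the set of trees with an accepting run. Leaf symbols are tuples $(a,b,c,d,k)\in\mathbb Z^5$ representing $(1/\sqrt2)^k(a+b\omega+c\omega^2+d\omega^3)$, $\omega=e^{i\pi/4}$. A tagged TA has binary symbols $x_k^j$ ($k$ the qubit, $j$ a tag) with distinct internal transitions carrying distinct symbols. A tagged $n$-qubit tree is a full binary tree of height $n$ whose internal nodes at depth $k-1$ are labelled by symbols $x_k^j$ and whose leaves are labelled in $\mathbb Z^5$; for $b=b_1\cdots b_n\in\{0,1\}^n$, $T(b)$ is the leaf reached by going at depth $k-1$ left if $b_k=0$ and right if $b_k=1$. $B_{x_t}\cdot T$ is the tree with the same internal labels as $T$ and leaf at $b$ equal to $T(b)$ if $b_t=1$ and $\mathbf 0$ if $b_t=0$; $B_{\overline{x_t}}\cdot T$ is the same with the roles of $b_t=0$ and $b_t=1$ exchanged. $\mathrm{Tag}(T)$ replaces every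 leaf label by a special symbol $\square$. For TAs $\mathcal A,\mathcal B$, $\mathcal B\simeq_{\mathrm{Tag}}\mathcal A$ means there is a bijection $S:\mathcal L(\mathcal A)\to\mathcal L(\mathcal B)$ with $\mathrm{Tag}(S(T))=\mathrm{Tag}(T)$ for all $T\in\mathcal L(\mathcal A)$. -}

module Defs where

open import Data.Nat using (ℕ; zero; suc; _≡ᵇ_)
open import Data.Integer using (ℤ; 0ℤ)
open import Data.Bool using (Bool; true; false; if_then_else_)
open import Data.Product using (Σ; _×_; _,_; ∃; proj₁)
open import Data.Sum using (_⊎_; inj₁; inj₂)
open import Data.Unit using (⊤; tt)
open import Data.Fin using (Fin)
open import Data.List using (List; map; _++_; concatMap)
open import Data.List.Membership.Propositional using (_∈_)
open import Function.Bundles using (_↔_)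
open import Relation.Binary.PropositionalEquality using (_≡_)

Leaf : Set
Leaf = ℤ × ℤ × ℤ × ℤ × ℤ

𝟎 : Leaf
𝟎 = 0ℤ , 0ℤ , 0ℤ , 0ℤ , 0ℤ

-- Binary symbol x_k^j, represented as (k , j): qubit k, tag j
Sym : Set
Sym = ℕ × ℕ

qubit : Sym → ℕ
qubit = proj₁

data BTree (L : Set) : Set where
  leaf : L → BTree L
  node : Sym → BTree L → BTree L → BTree L

Tree : Set
Tree = BTree Leaf

Tag : Tree → BTree ⊤
Tag (leaf _)     = leaf tt
Tag (node s l r) = node s (Tag l) (Tag r)

-- QT d n T : T is a full binary tree of height n whose root lies at
-- depth d, with internal nodes at depth k-1 labelled x_k^j.
data QT : ℕ → ℕ → Tree → Set where
  qt-leaf : ∀ {d c} → QT d zero (leaf c)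
  qt-node : ∀ {d n j l r} → QT (suc d) n l → QT (suc d) n r →
            QT d (suc n) (node (suc d , j) l r)

TaggedQubitTree : ℕ → Tree → Set
TaggedQubitTree n T = QT 0 n T

-- B_{x_t} · T (b = true) and B_{\bar x_t} · T (b = false).
-- The leaf at path b₁…bₙ is kept iff b_t = 1 (resp. b_t = 0), and is
-- replaced by 𝟎 otherwise; b_t is the direction taken at depth t-1.

zeroLeaves : Tree → Tree
zeroLeaves (leaf _)     = leaf 𝟎
zeroLeaves (node s l r) = node s (zeroLeaves l) (zeroLeaves r)

restrict : Bool → ℕ → Tree → Tree
restrict b zero T                    = T
restrict b (suc t) (leaf c)          = leaf c
restrict true  (suc zero) (node s l r) = node s (zeroLeaves l) r
restrict false (suc zero) (node s l r) = node s l (zeroLeaves r)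
restrict b (suc (suc t)) (node s l r) =
  node s (restrict b (suc t) l) (restrict b (suc t) r)

record ITrans (Q : Set) : Set where
  constructor _─[_]→_,_
  field
    src   : Q
    sym   : Sym
    left  : Q
    right : Q

record LTrans (Q : Set) : Set where
  constructor _─[_]→∙
  field
    lsrc : Q
    lsym : Leaf

record TA (Q : Set) : Set where
  field
    internal : List (ITrans Q)
    leaves   : List (LTrans Q)
    roots    : List Q
open TA public

Finite : Set → Set
Finite Q = Σ ℕ λ m → Q ↔ Fin m

LeafDeterministic : ∀ {Q} → TA Q → Set
LeafDeterministic {Q} A = ∀ {q : Q} {c c'} →
  (q ─[ c ]→∙) ∈ leaves A → (q ─[ c' ]→∙) ∈ leaves A → c ≡ c'

IsTagged : ∀ {Q} → TA Q → Set
IsTagged A = ∀ {τ τ'} → τ ∈ internal A → τ' ∈ internal A →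
  ITrans.sym τ ≡ ITrans.sym τ' → τ ≡ τ'

data Run {Q : Set} (A : TA Q) : Q → Tree → Set where
  run-leaf : ∀ {q c} → (q ─[ c ]→∙) ∈ leaves A → Run A q (leaf c)
  run-node : ∀ {q s q₀ q₁ l r} → (q ─[ s ]→ q₀ , q₁) ∈ internal A →
             Run A q₀ l → Run A q₁ r → Run A q (node s l r)

Lang : ∀ {Q} → TA Q → Tree → Set
Lang {Q} A T = Σ Q λ q → q ∈ roots A × Run A q T

-- B ≃_Tag A : a bijection S : L(A) → L(B) with Tag(S T) = Tag T
TagEquiv : ∀ {Q Q'} → TA Q' → TA Q → Set
TagEquiv B A = Σ (Tree → Tree) λ S →
    (∀ T → Lang A T → Lang B (S T))
  × (∀ T T' → Lang A T → Lang A T' → S T ≡ S T' → T ≡ T')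
  × (∀ T' → Lang B T' → Σ Tree λ T → Lang A T × S T ≡ T')
  × (∀ T → Lang A T → Tag (S T) ≡ Tag T)

-- Res(A, x_t, b), with states Q ∪ Q' = Q ⊎ Q (inj₁ q = q, inj₂ q = q')

resInternal : ∀ {Q} → ℕ → Bool → ITrans Q → ITrans (Q ⊎ Q)
resInternal t b (q ─[ s ]→ ql , qr) =
  if qubit s ≡ᵇ t
  then (if b then (inj₁ q ─[ s ]→ inj₂ ql , inj₁ qr)
             else (inj₁ q ─[ s ]→ inj₁ ql , inj₂ qr))
  else (inj₁ q ─[ s ]→ inj₁ ql , inj₁ qr)

primeInternal : ∀ {Q} → ITrans Q → ITrans (Q ⊎ Q)
primeInternal (q ─[ s ]→ ql , qr) = inj₂ q ─[ s ]→ inj₂ ql , inj₂ qr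

unprimeLeaf : ∀ {Q} → LTrans Q → LTrans (Q ⊎ Q)
unprimeLeaf (q ─[ c ]→∙) = inj₁ q ─[ c ]→∙

primeLeaf : ∀ {Q} → LTrans Q → LTrans (Q ⊎ Q)
primeLeaf (q ─[ c ]→∙) = inj₂ q ─[ 𝟎 ]→∙

Res : ∀ {Q} → TA Q → ℕ → Bool → TA (Q ⊎ Q)
Res A t b = record
  { internal = map (resInternal t b) (internal A) ++ map primeInternal (internal A)
  ; leaves   = map unprimeLeaf (leaves A) ++ map primeLeaf (leaves A)
  ; roots    = map inj₁ (roots A)
  }

module Submission where

-- A run of Res A t b is a run of A in which, below every node labelled x_t^j,
-- the left (b = true) or right (b = false) subtree is read in the primed copy
-- of A, whose runs are those of A with every leaf relabelled 𝟎. So the language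
-- of Res A t b is the image of the language of A under the map restricting at
-- the nodes of qubit t, which on tagged n-qubit trees is B_{x_t}· (resp.
-- B_{x̄_t}·). This map keeps Tag, and it is injective on the language of A since,
-- A being tagged and leaf-deterministic, the run on a tree, and with it the
-- tree itself, is determined by its Tag.

open import Defs
open import Data.Nat using (ℕ; _≤_; zero; suc; _+_; _≡ᵇ_; _≟_; s≤s)
open import Data.Nat.Properties
  using (≤-reflexive; m≤n⇒m≤1+n; +-identityʳ; +-suc; +-comm; >⇒≢; m+1+n≢m)
open import Data.Bool using (Bool; true; false; if_then_else_; _∧_; _∨_; not)
open import Data.Product using (Σ; _×_; _,_; ∃₂)
open import Data.Sum using (_⊎_; inj₁; inj₂)
open import Data.Empty using (⊥-elim)
open import Data.List using (List; map; _++_)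
open import Data.List.Properties using (map-cong)
open import Data.List.Membership.Propositional using (_∈_)
open import Data.List.Membership.Propositional.Properties
  using (∈-map⁺; ∈-map⁻; ∈-++⁺ˡ; ∈-++⁺ʳ; ∈-++⁻)
open import Function.Bundles using (_⇔_; mk⇔; Equivalence)
open import Function.Properties.Equivalence using () renaming (trans to ⇔-trans)
open import Relation.Nullary using (¬_)
open import Relation.Nullary.Decidable using (dec-true; dec-false)
open import Relation.Binary.PropositionalEquality
  using (_≡_; _≢_; refl; sym; trans; cong; cong₂; subst; ≢-sym)

splitMap : {X Y : Set} → (Bool → X → Y) → List X → List Y
splitMap f xs = map (f false) xs ++ map (f true) xs

∈-splitMap⁺ : {X Y : Set} (f : Bool → X → Y) {xs : List X} {x : X} →
  x ∈ xs → ∀ p → f p x ∈ splitMap f xs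
∈-splitMap⁺ f x∈xs false = ∈-++⁺ˡ (∈-map⁺ (f false) x∈xs)
∈-splitMap⁺ f x∈xs true  = ∈-++⁺ʳ _ (∈-map⁺ (f true) x∈xs)

∈-splitMap⁻ : {X Y : Set} (f : Bool → X → Y) {xs : List X} {y : Y} →
  y ∈ splitMap f xs → Σ Bool λ p → Σ X λ x → x ∈ xs × y ≡ f p x
∈-splitMap⁻ f {xs} y∈ with ∈-++⁻ (map (f false) xs) y∈
... | inj₁ y∈ˡ = let x , x∈xs , y≡ = ∈-map⁻ (f false) y∈ˡ in false , x , x∈xs , y≡
... | inj₂ y∈ʳ = let x , x∈xs , y≡ = ∈-map⁻ (f true) y∈ʳ in true , x , x∈xs , y≡

≡ᵇ-true : ∀ {m n} → m ≡ n → (m ≡ᵇ n) ≡ true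
≡ᵇ-true {m} {n} = dec-true (m ≟ n)

≡ᵇ-false : ∀ {m n} → m ≢ n → (m ≡ᵇ n) ≡ false
≡ᵇ-false {m} {n} = dec-false (m ≟ n)

node-injective : ∀ {L : Set} {s s' : Sym} {l r l' r' : BTree L} →
  node s l r ≡ node s' l' r' → s ≡ s' × l ≡ l' × r ≡ r'
node-injective refl = refl , refl , refl

module _ (b : Bool) (t : ℕ) where

  atQubit : Sym → Bool
  atQubit s = qubit s ≡ᵇ t

  leftPrimed rightPrimed : Bool → Sym → Bool
  leftPrimed  p s = p ∨ (atQubit s ∧ b)
  rightPrimed p s = p ∨ (atQubit s ∧ not b)

  primedLeaf : Bool → Leaf → Leaf
  primedLeaf p c = if p then 𝟎 else c

  -- If A reads T from q, then Res A t b reads primedImage false T from q and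
  -- primedImage true T from q′; a primed node stays primed.
  primedImage : Bool → Tree → Tree
  primedImage p (leaf c)     = leaf (primedLeaf p c)
  primedImage p (node s l r) =
    node s (primedImage (leftPrimed p s) l) (primedImage (rightPrimed p s) r)

  primedImage-true : ∀ T → primedImage true T ≡ zeroLeaves T
  primedImage-true (leaf c)     = refl
  primedImage-true (node s l r) = cong₂ (node s) (primedImage-true l) (primedImage-true r)

  Tag-primedImage : ∀ p T → Tag (primedImage p T) ≡ Tag T
  Tag-primedImage p (leaf c)     = refl
  Tag-primedImage p (node s l r) =
    cong₂ (node s) (Tag-primedImage (leftPrimed p s) l) (Tag-primedImage (rightPrimed p s) r)

primedIf : {Q : Set} → Bool → Q → Q ⊎ Q
primedIf false = inj₁
primedIf true  = inj₂

primedIf-injective : ∀ {Q : Set} {p p' : Bool} {q q' : Q} →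
  primedIf p q ≡ primedIf p' q' → p ≡ p' × q ≡ q'
primedIf-injective {p = false} {false} refl = refl , refl
primedIf-injective {p = true}  {true}  refl = refl , refl
primedIf-injective {p = false} {true}  ()
primedIf-injective {p = true}  {false} ()

primedTrans : {Q : Set} → Bool → ℕ → Bool → ITrans Q → ITrans (Q ⊎ Q)
primedTrans b t p (q ─[ s ]→ ql , qr) =
  primedIf p q ─[ s ]→ primedIf (leftPrimed b t p s) ql , primedIf (rightPrimed b t p s) qr

primedLeafTrans : {Q : Set} → Bool → ℕ → Bool → LTrans Q → LTrans (Q ⊎ Q)
primedLeafTrans b t p (q ─[ c ]→∙) = primedIf p q ─[ primedLeaf b t p c ]→∙

resInternal≗primedTrans : ∀ {Q : Set} b t (τ : ITrans Q) →
  resInternal t b τ ≡ primedTrans b t false τ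
resInternal≗primedTrans b t (q ─[ s ]→ ql , qr) with qubit s ≡ᵇ t | b
... | true  | true  = refl
... | true  | false = refl
... | false | _     = refl

module _ {Q : Set} (A : TA Q) (t : ℕ) (b : Bool) where

  Res-internal : internal (Res A t b) ≡ splitMap (primedTrans b t) (internal A)
  Res-internal = cong (_++ _) (map-cong (resInternal≗primedTrans b t) (internal A))

  private
    R : TA (Q ⊎ Q)
    R = Res A t b

  Res-internal⁺ : ∀ p {τ} → τ ∈ internal A → primedTrans b t p τ ∈ internal R
  Res-internal⁺ p τ∈ = subst (_ ∈_) (sym Res-internal) (∈-splitMap⁺ (primedTrans b t) τ∈ p)

  Res-leaves⁺ : ∀ p {λ₀} → λ₀ ∈ leaves A → primedLeafTrans b t p λ₀ ∈ leaves R
  Res-leaves⁺ p λ∈ = ∈-splitMap⁺ (primedLeafTrans b t) λ∈ p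

  Res-internal⁻ : ∀ p {q s x y} → (primedIf p q ─[ s ]→ x , y) ∈ internal R →
    ∃₂ λ ql qr → (q ─[ s ]→ ql , qr) ∈ internal A
      × x ≡ primedIf (leftPrimed b t p s) ql × y ≡ primedIf (rightPrimed b t p s) qr
  Res-internal⁻ p τ∈ with ∈-splitMap⁻ (primedTrans b t) (subst (_ ∈_) Res-internal τ∈)
  ... | _ , (_ ─[ _ ]→ ql , qr) , τ₀∈ , eq with primedIf-injective (cong ITrans.src eq) | eq
  ...   | refl , refl | refl = ql , qr , τ₀∈ , refl , refl

  Res-leaves⁻ : ∀ p {q c} → (primedIf p q ─[ c ]→∙) ∈ leaves R →
    Σ Leaf λ c₀ → (q ─[ c₀ ]→∙) ∈ leaves A × c ≡ primedLeaf b t p c₀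
  Res-leaves⁻ p λ∈ with ∈-splitMap⁻ (primedLeafTrans b t) λ∈
  ... | _ , (_ ─[ c₀ ]→∙) , λ₀∈ , eq with primedIf-injective (cong LTrans.lsrc eq) | eq
  ...   | refl , refl | refl = c₀ , λ₀∈ , refl

  run-primedImage : ∀ p {q T} → Run A q T → Run R (primedIf p q) (primedImage b t p T)
  run-primedImage p (run-leaf λ∈) = run-leaf (Res-leaves⁺ p λ∈)
  run-primedImage p (run-node τ∈ ρl ρr) =
    run-node (Res-internal⁺ p τ∈) (run-primedImage _ ρl) (run-primedImage _ ρr)

  run-primedImage⁻ : ∀ p {q T} → Run R (primedIf p q) T →
    Σ Tree λ T' → Run A q T' × T ≡ primedImage b t p T'
  run-primedImage⁻ p (run-leaf λ∈) with Res-leaves⁻ p λ∈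
  ... | c₀ , λ₀∈ , refl = leaf c₀ , run-leaf λ₀∈ , refl
  run-primedImage⁻ p (run-node {s = s} τ∈ ρl ρr) with Res-internal⁻ p τ∈
  ... | ql , qr , τ₀∈ , refl , refl
    with run-primedImage⁻ _ ρl | run-primedImage⁻ _ ρr
  ... | Tl , ρl' , refl | Tr , ρr' , refl = node s Tl Tr , run-node τ₀∈ ρl' ρr' , refl

  Lang-Res : ∀ T → Lang R T ⇔ Σ Tree λ T' → Lang A T' × T ≡ primedImage b t false T'
  Lang-Res T = mk⇔ to from
    where
    to : Lang R T → Σ Tree λ T' → Lang A T' × T ≡ primedImage b t false T'
    to (_ , q∈ , ρ) with ∈-map⁻ inj₁ q∈
    ... | q , q∈A , refl = let T' , ρ' , eq = run-primedImage⁻ false ρ in T' , (q , q∈A , ρ') , eq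
    from : (Σ Tree λ T' → Lang A T' × T ≡ primedImage b t false T') → Lang R T
    from (T' , (q , q∈A , ρ) , refl) = inj₁ q , ∈-map⁺ inj₁ q∈A , run-primedImage false ρ

primedImage-unaffected : ∀ b {t d m T} → QT d m T → t ≤ d → primedImage b t false T ≡ T
primedImage-unaffected b qt-leaf t≤d = refl
primedImage-unaffected b (qt-node ql qr) t≤d
  rewrite ≡ᵇ-false (>⇒≢ (s≤s t≤d)) =
  cong₂ (node _) (primedImage-unaffected b ql (m≤n⇒m≤1+n t≤d))
                 (primedImage-unaffected b qr (m≤n⇒m≤1+n t≤d))

-- restrict counts levels from the root of the subtree, whereas qubit labels
-- count them from the root of the whole tree; the subtree's root sits at depth d.
primedImage≡restrict : ∀ b {d m T} k → QT d m T →
  primedImage b (d + k) false T ≡ restrict b k T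
primedImage≡restrict b {d} zero ρ = primedImage-unaffected b ρ (≤-reflexive (+-identityʳ d))
primedImage≡restrict b (suc k) qt-leaf = refl
primedImage≡restrict true (suc zero) (qt-node {d} {l = l} ql qr)
  rewrite ≡ᵇ-true (+-comm 1 d) =
  cong₂ (node _) (primedImage-true true (d + 1) l)
                 (primedImage-unaffected true qr (≤-reflexive (+-comm d 1)))
primedImage≡restrict false (suc zero) (qt-node {d} {r = r} ql qr)
  rewrite ≡ᵇ-true (+-comm 1 d) =
  cong₂ (node _) (primedImage-unaffected false ql (≤-reflexive (+-comm d 1)))
                 (primedImage-true false (d + 1) r)
primedImage≡restrict true (suc (suc k)) (qt-node {d} ql qr)
  rewrite +-suc d (suc k) | ≡ᵇ-false (≢-sym (m+1+n≢m d {k})) =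
  cong₂ (node _) (primedImage≡restrict true (suc k) ql) (primedImage≡restrict true (suc k) qr)
primedImage≡restrict false (suc (suc k)) (qt-node {d} ql qr)
  rewrite +-suc d (suc k) | ≡ᵇ-false (≢-sym (m+1+n≢m d {k})) =
  cong₂ (node _) (primedImage≡restrict false (suc k) ql) (primedImage≡restrict false (suc k) qr)

module _ {Q : Set} {A : TA Q} (leafDet : LeafDeterministic A) (tagged : IsTagged A) where

  Run-Tag-injective : ∀ {q T T'} → Run A q T → Run A q T' → Tag T ≡ Tag T' → T ≡ T'
  Run-Tag-injective (run-leaf λ∈) (run-leaf λ∈') _ = cong leaf (leafDet λ∈ λ∈')
  Run-Tag-injective (run-node τ∈ ρl ρr) (run-node τ∈' ρl' ρr') eq
    with node-injective eq
  ... | refl , eqˡ , eqʳ with tagged τ∈ τ∈' refl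
  ...   | refl = cong₂ (node _) (Run-Tag-injective ρl ρl' eqˡ) (Run-Tag-injective ρr ρr' eqʳ)

  Run-root-unique : ∀ {q q' s l r l' r'} →
    Run A q (node s l r) → Run A q' (node s l' r') → q ≡ q'
  Run-root-unique (run-node τ∈ _ _) (run-node τ∈' _ _) = cong ITrans.src (tagged τ∈ τ∈' refl)

  Lang-Tag-injective : (∀ c → ¬ Lang A (leaf c)) →
    ∀ {T T'} → Lang A T → Lang A T' → Tag T ≡ Tag T' → T ≡ T'
  Lang-Tag-injective noLeaf {leaf c} LA _ _ = ⊥-elim (noLeaf c LA)
  Lang-Tag-injective noLeaf {node _ _ _} {leaf _} _ _ ()
  Lang-Tag-injective noLeaf {node _ _ _} {node _ _ _} (_ , _ , ρ) (_ , _ , ρ') eq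
    with node-injective eq
  ... | refl , _ , _ with Run-root-unique ρ ρ'
  ...   | refl = Run-Tag-injective ρ ρ' eq

TagEquiv-fromImage : ∀ {Q Q'} {A : TA Q} {B : TA Q'} (S : Tree → Tree) →
  (∀ T → Lang A T → Tag (S T) ≡ Tag T) →
  (∀ {T T'} → Lang A T → Lang A T' → Tag T ≡ Tag T' → T ≡ T') →
  (∀ T → Lang B T ⇔ Σ Tree λ T' → Lang A T' × T ≡ S T') →
  TagEquiv B A
TagEquiv-fromImage S Tag-S Tag-injective image =
    S
  , (λ T LA → Equivalence.from (image (S T)) (T , LA , refl))
  , (λ T T' LA LA' eq →
       Tag-injective LA LA' (trans (sym (Tag-S T LA)) (trans (cong Tag eq) (Tag-S T' LA'))))
  , (λ T LB → let T' , LA , eq = Equivalence.to (image T) LB in T' , LA , sym eq)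
  , Tag-S

image-cong : ∀ {P : Tree → Set} {f g : Tree → Tree} → (∀ T → P T → f T ≡ g T) →
  ∀ T → (Σ Tree λ T' → P T' × T ≡ f T') ⇔ (Σ Tree λ T' → P T' × T ≡ g T')
image-cong f≡g T = mk⇔ (λ (T' , PT' , eq) → T' , PT' , trans eq (f≡g T' PT'))
                       (λ (T' , PT' , eq) → T' , PT' , trans eq (sym (f≡g T' PT')))

theorem6p6 : {Q : Set} (A : TA Q) (n t : ℕ) (b : Bool) →
    Finite Q → LeafDeterministic A → IsTagged A →
    (∀ T → Lang A T → TaggedQubitTree n T) →
    1 ≤ t → t ≤ n →
    TagEquiv (Res A t b) A
    × (∀ T → Lang (Res A t b) T ⇔ Σ Tree (λ T' → Lang A T' × T ≡ restrict b t T'))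
theorem6p6 A (suc n) t b _ leafDet tagged qubitTrees _ (s≤s _) =
    TagEquiv-fromImage (restrict b t) Tag-restrict (Lang-Tag-injective leafDet tagged noLeaf) language
  , language
  where
  agrees : ∀ T → Lang A T → primedImage b t false T ≡ restrict b t T
  agrees T LA = primedImage≡restrict b t (qubitTrees T LA)

  language : ∀ T → Lang (Res A t b) T ⇔ Σ Tree (λ T' → Lang A T' × T ≡ restrict b t T')
  language T = ⇔-trans (Lang-Res A t b T) (image-cong agrees T)

  Tag-restrict : ∀ T → Lang A T → Tag (restrict b t T) ≡ Tag T
  Tag-restrict T LA = trans (cong Tag (sym (agrees T LA))) (Tag-primedImage b t false T)

  noLeaf : ∀ c → ¬ Lang A (leaf c)
  noLeaf c LA with qubitTrees (leaf c) LA
  ... | ()
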